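{- Let $p$ be a prime and let $m,n$ be positive integers. The power graph $\mathcal{G}(\mathbb{Z}_{p^m}^n)$ is a flower graph if and only if $n\ge 2$ and $m=1$.
   Context: For a finite group $G$, the power graph $\mathcal{G}(G)$ is the simple graph with vertex set $G$ in which two distinct vertices are adjacent if and only if one is a power of the other. $\mathbb{Z}_{k}$ denotes the cyclic group of order $k$ and $\mathbb{Z}_k^n$ the direct product of $n$ copies of $\mathbb{Z}_k$. A block graph is a graph in which every block (maximal connected subgraph without a cut vertex) is a complete graph; a flower graph is a block graph with exactly one cut vertex. -}

module Defs where

open import Data.Nat using (ℕ; _*_; _%_; NonZero)
open import Data.Fin using (Fin; toℕ)
open import Data.Vec using (Vec; lookup)
open import Data.Product using (Σ; ∃; _×_)
open import Data.Sum using (_⊎_)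
open import Data.Unit using (⊤)
open import Relation.Nullary using (¬_)
open import Relation.Binary.PropositionalEquality using (_≡_; _≢_)

module Graph {V : Set} (Adj : V → V → Set) where

  Subset : Set₁
  Subset = V → Set

  data Reach (S : Subset) : V → V → Set where
    here : ∀ {u} → S u → Reach S u u
    step : ∀ {u w v} → S u → Adj u w → Reach S w v → Reach S u v

  _─_ : Subset → V → Subset
  (S ─ c) x = S x × x ≢ c

  Full : Subset
  Full _ = ⊤

  IsCutVertexIn : Subset → V → Set
  IsCutVertexIn S c =
    S c × ∃ λ u → ∃ λ v → (S ─ c) u × (S ─ c) v × Reach S u v × ¬ Reach (S ─ c) u v

  Nonseparable : Subset → Set
  Nonseparable S =
    (∃ λ x → S x) × (∀ u v → S u → S v → Reach S u v) × (∀ c → ¬ IsCutVertexIn S c)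

  -- a block: maximal connected subgraph without a cut vertex
  -- (maximal such subgraphs are induced, so we work with vertex sets)
  IsBlock : Subset → Set₁
  IsBlock B = Nonseparable B × (∀ B′ → Nonseparable B′ → (∀ x → B x → B′ x) → ∀ x → B′ x → B x)

  IsBlockGraph : Set₁
  IsBlockGraph = ∀ B → IsBlock B → ∀ x y → B x → B y → x ≢ y → Adj x y

  IsCutVertex : V → Set
  IsCutVertex c = IsCutVertexIn Full c

  IsFlowerGraph : Set₁
  IsFlowerGraph = IsBlockGraph × ∃ λ c → IsCutVertex c × (∀ d → IsCutVertex d → d ≡ c)

-- The power graph of Z_q^n (written additively): elements are vectors
-- in Fin q; x is a "power" (multiple) of y iff x = k·y for some k ∈ ℕ.

Zⁿ : ℕ → ℕ → Set
Zⁿ q n = Vec (Fin q) n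

IsPowerOf : (q n : ℕ) .{{_ : NonZero q}} → Zⁿ q n → Zⁿ q n → Set
IsPowerOf q n x y = ∃ λ (k : ℕ) → ∀ i → toℕ (lookup x i) ≡ (k * toℕ (lookup y i)) % q

PowerAdj : (q n : ℕ) .{{_ : NonZero q}} → Zⁿ q n → Zⁿ q n → Set
PowerAdj q n x y = x ≢ y × (IsPowerOf q n x y ⊎ IsPowerOf q n y x)

module Submission where

open import Defs
open import Data.Nat using (ℕ; _^_; _≤_)
open import Data.Nat.Properties using (m^n≢0)
open import Data.Nat.Primality using (Prime; prime⇒nonZero)
open import Data.Product using (_×_)
open import Function.Bundles using (_⇔_)
open import Relation.Binary.PropositionalEquality using (_≡_)

open import Data.Nat using (zero; suc; pred; _+_; _*_; _%_; _<_; NonZero; >-nonZero; >-nonZero⁻¹; nonTrivial⇒n>1; z≤n; s≤s)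
  renaming (_≟_ to _≟ℕ_)
open import Data.Nat.Properties
  using (0≢1+n; 1+n≢0; n>0⇒n≢0; *-identityˡ; *-identityʳ; *-zeroʳ; *-assoc; *-comm; suc-pred; ≤-<-trans; <-≤-trans; m≤m*n; m<m*n; m^n>0; n≢0⇒n>0)
open import Data.Nat.DivMod using (m<n⇒m%n≡m; %-distribˡ-*; m%n%n≡m%n; m%n<n; %-remove-+ˡ; %-remove-+ʳ; m*n%n≡0)
open import Data.Nat.Divisibility using (∣-refl; divides)
open import Data.Nat.Primality using (prime⇒nonTrivial)
open import Data.Nat.Coprimality using (coprime-Bézout; prime⇒coprime)
open import Data.Nat.GCD using (module Bézout)
open import Data.Nat.Solver using (module +-*-Solver)
open import Data.Fin using (Fin; toℕ; fromℕ<)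
open import Data.Fin.Properties using (toℕ-fromℕ<; toℕ<n; toℕ-injective; any?; all?)
import Data.Fin as Fin
open import Data.Vec using (lookup; replicate; tabulate; _∷_; [])
open import Data.Vec.Properties using (≡-dec; lookup-replicate; tabulate∘lookup; tabulate-cong)
open import Data.Product using (∃-syntax; _,_; proj₂)
open import Data.Sum using (_⊎_; inj₁; inj₂)
open import Data.Unit using (tt)
open import Data.Empty using (⊥-elim)
open import Relation.Nullary using (¬_; Dec; yes; no)
open import Relation.Nullary.Decidable using (_×-dec_; _⊎-dec_; ¬?; decidable-stable)
open import Relation.Binary.Definitions using (DecidableEquality)
open import Relation.Binary.PropositionalEquality
  using (_≢_; refl; sym; trans; cong; subst; subst₂; ≢-sym; module ≡-Reasoning)
open import Function.Bundles using (mk⇔)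

-- The zero vector 0 is a power of every element, so it is a
-- *hub* of the power graph: adjacent to every other vertex.  The first part of
-- the file is pure graph theory for a simple graph with a hub h:
--   * no vertex other than h is a cut vertex, so two distinct hubs rule out
--     cut vertices altogether;
--   * h together with one component of G − h (a "petal") is a block;
--   * if every component of G − h is a clique, G is a block graph.  The
-- theorem then splits into three cases:
--   * n = 1: both 0 and 1 are hubs of Z_q, so there is no cut vertex;
--   * n ≥ 2, m ≥ 2: with r = p^(m-1) we have r² = 0, so (1,0,…) and (1,r,…)
--     both have (r,0,…) as a power and lie in one petal, yet are not adjacent;
--   * n ≥ 2, m = 1: Z_p is a field, so walks avoiding 0 only connect mutual
--     powers; petals are cliques, and (1,0,…), (0,1,…) lie in different
--     petals, so 0 is the unique cut vertex.

module HubGraph {V : Set} (Adj : V → V → Set)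
                (adj-sym : ∀ {x y} → Adj x y → Adj y x)
                (_≟_ : DecidableEquality V) where
  open Graph Adj

  start : ∀ {S u v} → Reach S u v → S u
  start (here s) = s
  start (step s _ _) = s

  widen : ∀ {S T : Subset} → (∀ {x} → S x → T x) → ∀ {u v} → Reach S u v → Reach T u v
  widen f (here s) = here (f s)
  widen f (step s a r) = step (f s) a (widen f r)

  _▸_ : ∀ {S u v w} → Reach S u v → Reach S v w → Reach S u w
  here _ ▸ r′ = r′
  step s a r ▸ r′ = step s a (r ▸ r′)

  reverse : ∀ {S u v} → Reach S u v → Reach S v u
  reverse (here s) = here s
  reverse (step s a r) = reverse r ▸ step (start r) (adj-sym a) (here s)

  IsHub : V → Set
  IsHub h = ∀ u → u ≢ h → Adj u h

  module Hub {h : V} (hub : IsHub h) where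

    toHub : ∀ {S : Subset} {u} → S h → S u → Reach S u h
    toHub {u = u} Sh Su with u ≟ h
    ... | yes refl = here Su
    ... | no u≢h = step Su (hub u u≢h) (here Sh)

    viaHub : ∀ {S : Subset} {u v} → S h → S u → S v → Reach S u v
    viaHub Sh Su Sv = toHub Sh Su ▸ reverse (toHub Sh Sv)

    -- Removing a vertex other than h leaves h, which still connects everything.
    onlyHubCuts : ∀ {S c} → S h → c ≢ h → ¬ IsCutVertexIn S c
    onlyHubCuts Sh c≢h (_ , _ , _ , Su , Sv , _ , ¬r) = ¬r (viaHub (Sh , ≢-sym c≢h) Su Sv)

    cutVertex⇒hub : ∀ c → IsCutVertex c → c ≡ h
    cutVertex⇒hub c cut with c ≟ h
    ... | yes c≡h = c≡h
    ... | no c≢h = ⊥-elim (onlyHubCuts tt c≢h cut)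

    Punctured : Subset
    Punctured = Full ─ h

    hub-isCut : ∀ {u v} → u ≢ h → v ≢ h → ¬ Reach Punctured u v → IsCutVertex h
    hub-isCut u≢h v≢h ¬r = tt , _ , _ , (tt , u≢h) , (tt , v≢h) , viaHub tt tt tt , ¬r

    -- The petal of v: h together with the component of v in G − h.  Membership
    -- is doubly negated, which is all that maximality of blocks can supply.
    Petal : V → Subset
    Petal v x = x ≡ h ⊎ ¬ ¬ Reach Punctured x v

    walk∈Petal : ∀ {x v} → Reach Punctured x v → Reach (Petal v ─ h) x v
    walk∈Petal r@(here s) = here (inj₂ (λ ¬r → ¬r r) , proj₂ s)
    walk∈Petal r@(step s a r′) = step (inj₂ (λ ¬r → ¬r r) , proj₂ s) a (walk∈Petal r′)

    linked∈Petal : ∀ {x v} → x ≢ h → v ≢ h → (x ≢ v → Adj x v) → Petal v x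
    linked∈Petal {x} {v} x≢h v≢h adj with x ≟ v
    ... | yes refl = inj₂ λ ¬r → ¬r (here (tt , v≢h))
    ... | no x≢v = inj₂ λ ¬r → ¬r (step (tt , x≢h) (adj x≢v) (here (tt , v≢h)))

    petal-isBlock : ∀ {v} → v ≢ h → IsBlock (Petal v)
    petal-isBlock {v} v≢h = ((h , inj₁ refl) , (λ _ _ → viaHub (inj₁ refl)) , noCut) , maximal
      where
      noCut : ∀ c → ¬ IsCutVertexIn (Petal v) c
      noCut c with c ≟ h
      ... | no c≢h = onlyHubCuts (inj₁ refl) c≢h
      ... | yes refl = λ where
        (_ , _ , _ , (inj₁ u≡h , u≢h) , _ , _ , _) → u≢h u≡h
        (_ , _ , _ , _ , (inj₁ w≡h , w≢h) , _ , _) → w≢h w≡h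
        (_ , _ , _ , (inj₂ u~v , _) , (inj₂ w~v , _) , _ , ¬r) →
          u~v λ ru → w~v λ rw → ¬r (walk∈Petal ru ▸ reverse (walk∈Petal rw))
      -- a larger nonseparable set containing x ∉ petal would have h as cut vertex
      maximal : ∀ B → Nonseparable B → (∀ x → Petal v x → B x) → ∀ x → B x → Petal v x
      maximal B (_ , conn , nc) sub x Bx with x ≟ h
      ... | yes x≡h = inj₁ x≡h
      ... | no x≢h = inj₂ λ ¬r → nc h (sub h (inj₁ refl) , x , v , (Bx , x≢h) , (Bv , v≢h)
                                        , conn x v Bx Bv , λ r → ¬r (widen (λ s → tt , proj₂ s) r))
        where
        Bv : B v
        Bv = sub v (inj₂ λ ¬r → ¬r (here (tt , v≢h)))

    -- If the components of G − h are cliques, every block is complete: two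
    -- non-hub vertices of a block stay connected inside it after removing h.
    cliquePetals⇒blockGraph : (∀ x y → Dec (Adj x y)) →
      (∀ {x y} → Reach Punctured x y → x ≢ y → Adj x y) → IsBlockGraph
    cliquePetals⇒blockGraph adj? clique B ((_ , conn , nc) , _) x y Bx By x≢y with x ≟ h | y ≟ h
    ... | yes refl | _ = adj-sym (hub y (≢-sym x≢y))
    ... | no _ | yes refl = hub x x≢y
    ... | no x≢h | no y≢h =
      decidable-stable (adj? x y) λ ¬adj → notSeparated λ r → ¬adj (clique (widen (λ s → tt , proj₂ s) r) x≢y)
      where
      -- a vertex of the walk equal to h would make h a cut vertex of B
      notSeparated : ¬ ¬ Reach (B ─ h) x y
      notSeparated ¬r = ¬r (widen (λ {w} Bw → Bw , λ w≡h →
        nc h (subst B w≡h Bw , x , y , (Bx , x≢h) , (By , y≢h) , conn x y Bx By , ¬r)) (conn x y Bx By))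

  twoHubs⇒noCut : ∀ {h₁ h₂} → h₁ ≢ h₂ → IsHub h₁ → IsHub h₂ → ∀ c → ¬ IsCutVertex c
  twoHubs⇒noCut h₁≢h₂ hub₁ hub₂ c cut =
    h₁≢h₂ (trans (sym (Hub.cutVertex⇒hub hub₁ c cut)) (Hub.cutVertex⇒hub hub₂ c cut))

module Residues (q : ℕ) .{{_ : NonZero q}} where

  residue : ℕ → Fin q
  residue s = fromℕ< (m%n<n s q)

  toℕ-residue : ∀ s → toℕ (residue s) ≡ s % q
  toℕ-residue s = toℕ-fromℕ< (m%n<n s q)

  0%q≡0 : 0 % q ≡ 0
  0%q≡0 = m<n⇒m%n≡m (>-nonZero⁻¹ q)

  toℕ%q : ∀ (a : Fin q) → toℕ a % q ≡ toℕ a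
  toℕ%q a = m<n⇒m%n≡m (toℕ<n a)

  *-%ʳ : ∀ a b → (a * (b % q)) % q ≡ (a * b) % q
  *-%ʳ a b = begin
    (a * (b % q)) % q           ≡⟨ %-distribˡ-* a (b % q) q ⟩
    ((a % q) * (b % q % q)) % q ≡⟨ cong (λ t → ((a % q) * t) % q) (m%n%n≡m%n b q) ⟩
    ((a % q) * (b % q)) % q     ≡⟨ %-distribˡ-* a b q ⟨
    (a * b) % q                 ∎
    where open ≡-Reasoning

  *-%ˡ : ∀ a b → ((a % q) * b) % q ≡ (a * b) % q
  *-%ˡ a b = begin
    ((a % q) * b) % q ≡⟨ cong (_% q) (*-comm (a % q) b) ⟩
    (b * (a % q)) % q ≡⟨ *-%ʳ b a ⟩
    (b * a) % q       ≡⟨ cong (_% q) (*-comm b a) ⟩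
    (a * b) % q       ∎
    where open ≡-Reasoning

  residue-scale : ∀ k {s s′} → s′ % q ≡ (k * s) % q →
                  toℕ (residue s′) ≡ (k * toℕ (residue s)) % q
  residue-scale k {s} {s′} s′≡ks = begin
    toℕ (residue s′)           ≡⟨ toℕ-residue s′ ⟩
    s′ % q                     ≡⟨ s′≡ks ⟩
    (k * s) % q                ≡⟨ *-%ʳ k s ⟨
    (k * (s % q)) % q          ≡⟨ cong (λ t → (k * t) % q) (toℕ-residue s) ⟨
    (k * toℕ (residue s)) % q  ∎
    where open ≡-Reasoning

bézout⇒inverse : ∀ {q c} .{{_ : NonZero q}} → 1 < q → Bézout.Identity 1 q c → ∃[ b ] (b * c) % q ≡ 1
bézout⇒inverse {q} {c} 1<q (Bézout.-+ x y 1+xq≡yc) = y , (begin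
  (y * c) % q     ≡⟨ cong (_% q) 1+xq≡yc ⟨
  (1 + x * q) % q ≡⟨ %-remove-+ʳ 1 (divides x refl) ⟩
  1 % q           ≡⟨ m<n⇒m%n≡m 1<q ⟩
  1               ∎)
  where open ≡-Reasoning
bézout⇒inverse {q} {c} 1<q (Bézout.+- x y 1+yc≡xq) = s * y , (begin
  (s * y * c) % q     ≡⟨ %-remove-+ʳ (s * y * c) (∣-refl {q}) ⟨
  (s * y * c + q) % q ≡⟨ cong (_% q) regroup ⟩
  (s * x * q + 1) % q ≡⟨ %-remove-+ˡ 1 (divides (s * x) refl) ⟩
  1 % q               ≡⟨ m<n⇒m%n≡m 1<q ⟩
  1                   ∎)
  where
  open ≡-Reasoning
  open +-*-Solver
  -- s = q − 1 plays the role of −1 modulo q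
  s : ℕ
  s = pred q
  regroup : s * y * c + q ≡ s * x * q + 1
  regroup = begin
    s * y * c + q       ≡⟨ cong (s * y * c +_) (suc-pred q) ⟨
    s * y * c + suc s   ≡⟨ solve 3 (λ s y c → (s :* y) :* c :+ (con 1 :+ s) := s :* (con 1 :+ y :* c) :+ con 1) refl s y c ⟩
    s * (1 + y * c) + 1 ≡⟨ cong (λ t → s * t + 1) 1+yc≡xq ⟩
    s * (x * q) + 1     ≡⟨ cong (_+ 1) (*-assoc s x q) ⟨
    s * x * q + 1       ∎

prime>1 : ∀ {p} → Prime p → 1 < p
prime>1 {p} p-prime = nonTrivial⇒n>1 p {{prime⇒nonTrivial p-prime}}

prime⇒invertible : ∀ {q} .{{_ : NonZero q}} → Prime q → ∀ k → k % q ≢ 0 → ∃[ b ] (b * k) % q ≡ 1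
prime⇒invertible {q} q-prime k k≢0 =
  let b , bk%q≡1 = bézout⇒inverse (prime>1 q-prime) (coprime-Bézout (prime⇒coprime q-prime {{k%q≢0}} (m%n<n k q)))
  in b , trans (sym (Residues.*-%ʳ q b k)) bk%q≡1
  where
  k%q≢0 : NonZero (k % q)
  k%q≢0 = >-nonZero (n≢0⇒n>0 k≢0)

module PowerGraph (q : ℕ) .{{_ : NonZero q}} (n : ℕ) where
  open Residues q

  V : Set
  V = Zⁿ q n

  Pow : V → V → Set
  Pow = IsPowerOf q n

  Adj : V → V → Set
  Adj = PowerAdj q n

  val : V → Fin n → ℕ
  val x i = toℕ (lookup x i)

  vec-ext : ∀ {x y} → (∀ i → val x i ≡ val y i) → x ≡ y
  vec-ext {x} {y} x≗y = begin
    x                   ≡⟨ tabulate∘lookup x ⟨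
    tabulate (lookup x) ≡⟨ tabulate-cong (λ i → toℕ-injective (x≗y i)) ⟩
    tabulate (lookup y) ≡⟨ tabulate∘lookup y ⟩
    y                   ∎
    where open ≡-Reasoning

  coord-≢ : ∀ {x y} i → val x i ≢ val y i → x ≢ y
  coord-≢ i xᵢ≢yᵢ x≡y = xᵢ≢yᵢ (cong (λ z → val z i) x≡y)

  _≟_ : DecidableEquality V
  _≟_ = ≡-dec Fin._≟_

  0ᵥ : V
  0ᵥ = replicate n (residue 0)

  val-0ᵥ : ∀ i → val 0ᵥ i ≡ 0
  val-0ᵥ i = trans (cong toℕ (lookup-replicate i (residue 0))) (trans (toℕ-residue 0) 0%q≡0)

  ≢0ᵥ : ∀ {x} i → val x i ≢ 0 → x ≢ 0ᵥ
  ≢0ᵥ i xᵢ≢0 = coord-≢ i λ xᵢ≡0ᵢ → xᵢ≢0 (trans xᵢ≡0ᵢ (val-0ᵥ i))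

  adj-sym : ∀ {x y} → Adj x y → Adj y x
  adj-sym (x≢y , inj₁ x^y) = ≢-sym x≢y , inj₂ x^y
  adj-sym (x≢y , inj₂ y^x) = ≢-sym x≢y , inj₁ y^x

  pow-refl : ∀ {x} → Pow x x
  pow-refl {x} = 1 , λ i → sym (trans (cong (_% q) (*-identityˡ (val x i))) (toℕ%q (lookup x i)))

  pow-trans : ∀ {x y z} → Pow x y → Pow y z → Pow x z
  pow-trans {x} {y} {z} (a , x≡ay) (b , y≡bz) = a * b , λ i → begin
    val x i                       ≡⟨ x≡ay i ⟩
    (a * val y i) % q             ≡⟨ cong (λ t → (a * t) % q) (y≡bz i) ⟩
    (a * ((b * val z i) % q)) % q ≡⟨ *-%ʳ a _ ⟩
    (a * (b * val z i)) % q       ≡⟨ cong (_% q) (*-assoc a b _) ⟨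
    (a * b * val z i) % q         ∎
    where open ≡-Reasoning

  -- Only the residue of the exponent matters, so it suffices to search Fin q.
  pow? : ∀ x y → Dec (Pow x y)
  pow? x y with any? (λ (k : Fin q) → all? (λ i → val x i ≟ℕ (toℕ k * val y i) % q))
  ... | yes (k , x≡ky) = yes (toℕ k , x≡ky)
  ... | no ¬∃k = no λ (k , x≡ky) → ¬∃k (residue k , λ i → trans (x≡ky i) (sym (residue-coefficient k i)))
    where
    residue-coefficient : ∀ k i → (toℕ (residue k) * val y i) % q ≡ (k * val y i) % q
    residue-coefficient k i = trans (cong (λ t → (t * val y i) % q) (toℕ-residue k)) (*-%ˡ k _)

  adj? : ∀ x y → Dec (Adj x y)
  adj? x y = ¬? (x ≟ y) ×-dec (pow? x y ⊎-dec pow? y x)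

  open HubGraph Adj adj-sym _≟_ public

  zero-hub : IsHub 0ᵥ
  zero-hub u u≢0 = u≢0 , inj₂ (0 , λ i → trans (val-0ᵥ i) (sym 0%q≡0))

  pow-support : ∀ {x y} i → val y i ≡ 0 → val x i ≢ 0 → ¬ Pow x y
  pow-support {x} {y} i yᵢ≡0 xᵢ≢0 (k , x≡ky) = xᵢ≢0 (begin
    val x i           ≡⟨ x≡ky i ⟩
    (k * val y i) % q ≡⟨ cong (λ t → (k * t) % q) yᵢ≡0 ⟩
    (k * 0) % q       ≡⟨ cong (_% q) (*-zeroʳ k) ⟩
    0 % q             ≡⟨ 0%q≡0 ⟩
    0                 ∎)
    where open ≡-Reasoning

  reduce-exponent : ∀ {x y} k → (∀ i → val x i ≡ (k * val y i) % q) →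
                    ∀ i → val x i ≡ ((k % q) * val y i) % q
  reduce-exponent {x} {y} k x≡ky i = trans (x≡ky i) (sym (*-%ˡ k _))

  -- If x = k·y and both have coordinate 1 at i, then k ≡ 1 and so x = y.
  pow-sharedOne : ∀ {x y} i → val x i ≡ 1 → val y i ≡ 1 → Pow x y → x ≡ y
  pow-sharedOne {x} {y} i xᵢ≡1 yᵢ≡1 (k , x≡ky) = vec-ext λ j → begin
    val x j                   ≡⟨ reduce-exponent {x} {y} k x≡ky j ⟩
    ((k % q) * val y j) % q   ≡⟨ cong (λ t → (t * val y j) % q) k≡1 ⟩
    (1 * val y j) % q         ≡⟨ cong (_% q) (*-identityˡ (val y j)) ⟩
    val y j % q               ≡⟨ toℕ%q (lookup y j) ⟩
    val y j                   ∎
    where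
    open ≡-Reasoning
    k≡1 : k % q ≡ 1
    k≡1 = begin
      k % q             ≡⟨ cong (_% q) (*-identityʳ k) ⟨
      (k * 1) % q       ≡⟨ cong (λ t → (k * t) % q) yᵢ≡1 ⟨
      (k * val y i) % q ≡⟨ x≡ky i ⟨
      val x i           ≡⟨ xᵢ≡1 ⟩
      1                 ∎

  ¬adj-sharedOne : ∀ {x y} i → val x i ≡ 1 → val y i ≡ 1 → ¬ Adj x y
  ¬adj-sharedOne i xᵢ≡1 yᵢ≡1 (x≢y , inj₁ x^y) = x≢y (pow-sharedOne i xᵢ≡1 yᵢ≡1 x^y)
  ¬adj-sharedOne i xᵢ≡1 yᵢ≡1 (x≢y , inj₂ y^x) = x≢y (sym (pow-sharedOne i yᵢ≡1 xᵢ≡1 y^x))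

  exponent≢0 : ∀ {x y} → x ≢ 0ᵥ → ∀ k → (∀ i → val x i ≡ (k * val y i) % q) → k % q ≢ 0
  exponent≢0 {x} {y} x≢0 k x≡ky k≡0 = x≢0 (vec-ext λ i → begin
    val x i                 ≡⟨ reduce-exponent {x} {y} k x≡ky i ⟩
    ((k % q) * val y i) % q ≡⟨ cong (λ t → (t * val y i) % q) k≡0 ⟩
    0 % q                   ≡⟨ 0%q≡0 ⟩
    0                       ≡⟨ val-0ᵥ i ⟨
    val 0ᵥ i                ∎)
    where open ≡-Reasoning

  pow-inverse : ∀ {x y} k b → (b * k) % q ≡ 1 → (∀ i → val x i ≡ (k * val y i) % q) → Pow y x
  pow-inverse {x} {y} k b bk≡1 x≡ky = b , λ i → sym (begin
    (b * val x i) % q             ≡⟨ cong (λ t → (b * t) % q) (x≡ky i) ⟩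
    (b * ((k * val y i) % q)) % q ≡⟨ *-%ʳ b _ ⟩
    (b * (k * val y i)) % q       ≡⟨ cong (_% q) (*-assoc b k _) ⟨
    (b * k * val y i) % q         ≡⟨ *-%ˡ (b * k) _ ⟨
    ((b * k % q) * val y i) % q   ≡⟨ cong (λ t → (t * val y i) % q) bk≡1 ⟩
    (1 * val y i) % q             ≡⟨ cong (_% q) (*-identityˡ _) ⟩
    val y i % q                   ≡⟨ toℕ%q (lookup y i) ⟩
    val y i                       ∎)
    where open ≡-Reasoning

-- In Z_q (q > 1) the generator 1 is a second hub, so there is no cut vertex.
cyclic-noCut : ∀ q .{{_ : NonZero q}} → 1 < q → ∀ c → ¬ Graph.IsCutVertex (PowerAdj q 1) c
cyclic-noCut q 1<q = twoHubs⇒noCut 0≢1 zero-hub one-hub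
  where
  open Residues q
  open PowerGraph q 1

  1ᵥ : V
  1ᵥ = residue 1 ∷ []

  val-1ᵥ : val 1ᵥ Fin.zero ≡ 1
  val-1ᵥ = trans (toℕ-residue 1) (m<n⇒m%n≡m 1<q)

  0≢1 : 0ᵥ ≢ 1ᵥ
  0≢1 = coord-≢ Fin.zero λ 0≡1 → 0≢1+n (trans (sym (val-0ᵥ Fin.zero)) (trans 0≡1 val-1ᵥ))

  one-hub : IsHub 1ᵥ
  one-hub (a ∷ []) a≢1 = a≢1 , inj₁ (toℕ a , λ { Fin.zero → sym (begin
    (toℕ a * val 1ᵥ Fin.zero) % q ≡⟨ cong (λ t → (toℕ a * t) % q) val-1ᵥ ⟩
    (toℕ a * 1) % q               ≡⟨ cong (_% q) (*-identityʳ (toℕ a)) ⟩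
    toℕ a % q                     ≡⟨ toℕ%q a ⟩
    toℕ a                         ∎) })
    where open ≡-Reasoning

module Plane (q : ℕ) .{{_ : NonZero q}} (1<q : 1 < q) (n : ℕ) where
  open Residues q
  open PowerGraph q (2 + n)

  ⟨_,_⟩ : ℕ → ℕ → V
  ⟨ s , t ⟩ = residue s ∷ residue t ∷ replicate n (residue 0)

  val₀ : ∀ s t → val ⟨ s , t ⟩ Fin.zero ≡ s % q
  val₀ s t = toℕ-residue s

  val₁ : ∀ s t → val ⟨ s , t ⟩ (Fin.suc Fin.zero) ≡ t % q
  val₁ s t = toℕ-residue t

  one₀ : ∀ t → val ⟨ 1 , t ⟩ Fin.zero ≡ 1
  one₀ t = trans (val₀ 1 t) (m<n⇒m%n≡m 1<q)

  one₁ : ∀ s → val ⟨ s , 1 ⟩ (Fin.suc Fin.zero) ≡ 1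
  one₁ s = trans (val₁ s 1) (m<n⇒m%n≡m 1<q)

  zero₀ : ∀ t → val ⟨ 0 , t ⟩ Fin.zero ≡ 0
  zero₀ t = trans (val₀ 0 t) 0%q≡0

  zero₁ : ∀ s → val ⟨ s , 0 ⟩ (Fin.suc Fin.zero) ≡ 0
  zero₁ s = trans (val₁ s 0) 0%q≡0

  one⇒≢0ᵥ : ∀ {x} i → val x i ≡ 1 → x ≢ 0ᵥ
  one⇒≢0ᵥ i xᵢ≡1 = ≢0ᵥ i λ xᵢ≡0 → 1+n≢0 (trans (sym xᵢ≡1) xᵢ≡0)

  pair-pow : ∀ k {s t s′ t′} → s′ % q ≡ (k * s) % q → t′ % q ≡ (k * t) % q →
             Pow ⟨ s′ , t′ ⟩ ⟨ s , t ⟩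
  pair-pow k s′≡ks t′≡kt = k , λ where
    Fin.zero → residue-scale k s′≡ks
    (Fin.suc Fin.zero) → residue-scale k t′≡kt
    (Fin.suc (Fin.suc j)) → subst₂ (λ a b → toℕ a ≡ (k * toℕ b) % q)
      (sym (lookup-replicate j (residue 0))) (sym (lookup-replicate j (residue 0)))
      (residue-scale k (cong (_% q) (sym (*-zeroʳ k))))

-- If Z_q has a nonzero r with r² ≡ 0, then a = (1,0,…) and b = (1,r,…) both
-- have e = (r,0,…) = r·a = r·b as a power, so they lie in the petal of e, which
-- is a block; but a and b share the coordinate 1 and are not adjacent.
zeroDivisor⇒¬blockGraph : ∀ q .{{_ : NonZero q}} n r → 0 < r → r < q → (r * r) % q ≡ 0 →
                          ¬ Graph.IsBlockGraph (PowerAdj q (2 + n))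
zeroDivisor⇒¬blockGraph q n r 0<r r<q r²≡0 isBlockGraph =
  ¬adj-sharedOne Fin.zero (one₀ 0) (one₀ r) (isBlockGraph (Petal e) (petal-isBlock e≢0) a b a∈ b∈ a≢b)
  where
  open Residues q
  open PowerGraph q (2 + n)
  open Plane q (≤-<-trans 0<r r<q) n
  open Hub zero-hub

  a b e : V
  a = ⟨ 1 , 0 ⟩
  b = ⟨ 1 , r ⟩
  e = ⟨ r , 0 ⟩

  r%q≡r : r % q ≡ r
  r%q≡r = m<n⇒m%n≡m r<q

  r≢0 : r ≢ 0
  r≢0 = n>0⇒n≢0 0<r

  e≢0 : e ≢ 0ᵥ
  e≢0 = ≢0ᵥ Fin.zero λ e₀≡0 → r≢0 (trans (sym r%q≡r) (trans (sym (val₀ r 0)) e₀≡0))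

  a≢b : a ≢ b
  a≢b = coord-≢ (Fin.suc Fin.zero) λ a₁≡b₁ →
    r≢0 (trans (sym r%q≡r) (trans (sym (val₁ 1 r)) (trans (sym a₁≡b₁) (zero₁ 1))))

  e^a : Pow e a
  e^a = pair-pow r (cong (_% q) (sym (*-identityʳ r))) (cong (_% q) (sym (*-zeroʳ r)))

  e^b : Pow e b
  e^b = pair-pow r (cong (_% q) (sym (*-identityʳ r))) (trans 0%q≡0 (sym r²≡0))

  a∈ : Petal e a
  a∈ = linked∈Petal (one⇒≢0ᵥ Fin.zero (one₀ 0)) e≢0 λ a≢e → a≢e , inj₂ e^a

  b∈ : Petal e b
  b∈ = linked∈Petal (one⇒≢0ᵥ Fin.zero (one₀ r)) e≢0 λ b≢e → b≢e , inj₂ e^b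

-- Over a prime modulus, walks avoiding 0 only connect mutual powers, so the
-- components of G − 0 are cliques and the power graph is a block graph.
module PrimeModulus (q : ℕ) .{{_ : NonZero q}} (q-prime : Prime q) (n : ℕ) where
  open PowerGraph q n
  open Graph Adj
  open Hub zero-hub

  -- Nonzero x = k·y forces k ≢ 0, which is invertible, so y is a power of x.
  pow-sym : ∀ {x y} → x ≢ 0ᵥ → Pow x y → Pow y x
  pow-sym {x} {y} x≢0 (k , x≡ky) =
    let b , bk≡1 = prime⇒invertible q-prime k (exponent≢0 {x} {y} x≢0 k x≡ky)
    in pow-inverse {x} {y} k b bk≡1 x≡ky

  -- Power is transitive and, away from 0, symmetric; so it is constant along walks.
  reach⇒pow : ∀ {x y} → Reach Punctured x y → Pow x y
  reach⇒pow {x} (here _) = pow-refl {x}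
  reach⇒pow {x} {y} (step {w = w} _ (_ , x~w) r) = pow-trans {x} {w} {y} (oriented x~w) (reach⇒pow r)
    where
    oriented : Pow x w ⊎ Pow w x → Pow x w
    oriented (inj₁ x^w) = x^w
    oriented (inj₂ w^x) = pow-sym {w} {x} (proj₂ (start r)) w^x

  blockGraph : IsBlockGraph
  blockGraph = cliquePetals⇒blockGraph adj? λ r x≢y → x≢y , inj₁ (reach⇒pow r)

-- For q prime and n ≥ 2, 0 is the unique cut vertex: a = (1,0,…) and
-- d = (0,1,…) are nonzero and a is not a power of d, so they are separated by 0.
prime⇒flower : ∀ q .{{_ : NonZero q}} → Prime q → ∀ n → Graph.IsFlowerGraph (PowerAdj q (2 + n))
prime⇒flower q q-prime n = blockGraph , 0ᵥ , hub-isCut a≢0 d≢0 (λ r → ¬a^d (reach⇒pow r)) , cutVertex⇒hub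
  where
  open PowerGraph q (2 + n)
  open PrimeModulus q q-prime (2 + n)
  open Plane q (prime>1 q-prime) n
  open Hub zero-hub

  a d : V
  a = ⟨ 1 , 0 ⟩
  d = ⟨ 0 , 1 ⟩

  a≢0 : a ≢ 0ᵥ
  a≢0 = one⇒≢0ᵥ Fin.zero (one₀ 0)

  d≢0 : d ≢ 0ᵥ
  d≢0 = one⇒≢0ᵥ (Fin.suc Fin.zero) (one₁ 0)

  ¬a^d : ¬ Pow a d
  ¬a^d = pow-support {a} {d} Fin.zero (zero₀ 1) λ a₀≡0 → 1+n≢0 (trans (sym (one₀ 0)) a₀≡0)

primePower≢0 : ∀ {p} → Prime p → ∀ k → NonZero (p ^ k)
primePower≢0 {p} p-prime k = m^n≢0 p k {{prime⇒nonZero p-prime}}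

1<primePower : ∀ {p} → Prime p → ∀ k → 1 < p ^ suc k
1<primePower {p} p-prime k = <-≤-trans (prime>1 p-prime) (m≤m*n p (p ^ k) {{primePower≢0 p-prime k}})

-- For m ≥ 2, r = p^(m-1) is a nonzero zero divisor of Z_(p^m): r² = p^(m-2)·p^m.
primePower-¬blockGraph : ∀ {p} (p-prime : Prime p) k n →
  ¬ Graph.IsBlockGraph (PowerAdj (p ^ (2 + k)) (2 + n) {{primePower≢0 p-prime (2 + k)}})
primePower-¬blockGraph {p} p-prime k n =
  zeroDivisor⇒¬blockGraph (p * r) n r (m^n>0 p (1 + k)) r<pr r²≡0
  where
  r : ℕ
  r = p ^ (1 + k)

  instance
    p≢0 : NonZero p
    p≢0 = prime⇒nonZero p-prime
    pr≢0 : NonZero (p * r)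
    pr≢0 = primePower≢0 p-prime (2 + k)

  r<pr : r < p * r
  r<pr = subst (r <_) (*-comm r p) (m<m*n r p {{primePower≢0 p-prime (1 + k)}} (prime>1 p-prime))

  r²≡0 : (r * r) % (p * r) ≡ 0
  r²≡0 = begin
    (r * r) % (p * r)           ≡⟨ cong (λ t → (t * r) % (p * r)) (*-comm p (p ^ k)) ⟩
    (p ^ k * p * r) % (p * r)   ≡⟨ cong (_% (p * r)) (*-assoc (p ^ k) p r) ⟩
    (p ^ k * (p * r)) % (p * r) ≡⟨ m*n%n≡0 (p ^ k) (p * r) ⟩
    0                           ∎
    where open ≡-Reasoning

theorem3p1 : (p m n : ℕ) (pr : Prime p) → 1 ≤ m → 1 ≤ n →
    Graph.IsFlowerGraph (PowerAdj (p ^ m) n {{m^n≢0 p m {{prime⇒nonZero pr}}}})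
      ⇔ (2 ≤ n × m ≡ 1)
theorem3p1 p zero n pr () _
theorem3p1 p (suc m) zero pr _ ()
theorem3p1 p (suc m) 1 pr _ _ =
  mk⇔ (λ (_ , c , cut , _) → ⊥-elim (cyclic-noCut (p ^ suc m) {{primePower≢0 pr (suc m)}} (1<primePower pr m) c cut))
      (λ { (s≤s () , _) })
theorem3p1 p 1 (suc (suc n)) pr _ _ =
  mk⇔ (λ _ → s≤s (s≤s z≤n) , refl)
      (λ _ → prime⇒flower (p ^ 1) {{primePower≢0 pr 1}} (subst Prime (sym (*-identityʳ p)) pr) n)
theorem3p1 p (suc (suc m)) (suc (suc n)) pr _ _ =
  mk⇔ (λ (isBlockGraph , _) → ⊥-elim (primePower-¬blockGraph pr m n isBlockGraph))
      (λ { (_ , ()) })
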